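{- Let $H=(V,E)$ be a $d$-uniform hypergraph with $d\ge 2$. Then there exists a $d$-uniform hypergraph $H'$ such that $H=H'[V]$ and $\mathrm{Z}_0(H')=0$.
   Context: For a $d$-hypergraph $H'$ and $U\subseteq V(H')$, the induced subhypergraph $H'[U]$ has vertex set $U$ and edge set consisting of all edges of $H'$ that are contained in $U$. $\mathrm{Z}_0$: with a set $B$ initially blue and the other vertices white, a set $S$ of $d-1$ distinct vertices (not necessarily blue) can turn a white vertex $w$ blue if $S\cup\{w\}$ is an edge and every white $u$ such that $S\cup\{u\}$ is an edge equals $w$. $B$ is a zero forcing set if repeated application colors all vertices blue; $\mathrm{Z}_0$ is the minimum cardinality of a zero forcing set. -}

module Defs where

open import Level using (0ℓ)
open import Data.Nat using (ℕ; _≤_; _∸_; _+_)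
open import Data.Bool using (false)
open import Data.Fin using (Fin)
open import Data.Fin.Subset using (Subset; _∈_; _∉_; _∪_; ⁅_⁆; ∣_∣; ⊥; ⊤)
open import Data.Vec using (_++_; replicate)
open import Data.Product using (Σ; ∃; _×_)
open import Relation.Binary.PropositionalEquality using (_≡_)
open import Relation.Binary.Construct.Closure.ReflexiveTransitive using (Star)
open import Function.Bundles using (_⇔_)

record Hypergraph (d n : ℕ) : Set₁ where
  field
    IsEdge  : Subset n → Set
    uniform : ∀ e → IsEdge e → ∣ e ∣ ≡ d
open Hypergraph public

data ForceStep {d m : ℕ} (H : Hypergraph d m) : Subset m → Subset m → Set where
  force : ∀ {B} (S : Subset m) (w : Fin m)
        → ∣ S ∣ ≡ d ∸ 1
        → w ∉ B
        → IsEdge H (S ∪ ⁅ w ⁆)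
        → (∀ u → u ∉ B → IsEdge H (S ∪ ⁅ u ⁆) → u ≡ w)
        → ForceStep H B (B ∪ ⁅ w ⁆)

IsZeroForcingSet : ∀ {d m} → Hypergraph d m → Subset m → Set
IsZeroForcingSet H B = Star (ForceStep H) B ⊤

Z₀≡ : ∀ {d m} → Hypergraph d m → ℕ → Set
Z₀≡ {m = m} H k =
  (Σ (Subset m) λ B → IsZeroForcingSet H B × ∣ B ∣ ≡ k)
  × (∀ B → IsZeroForcingSet H B → k ≤ ∣ B ∣)

-- The vertex set Fin n is identified with the first n vertices of Fin (n + k);
-- a subset e of Fin n corresponds to e ++ (all false) in Fin (n + k).
embed : ∀ {n} k → Subset n → Subset (n + k)
embed k e = e ++ replicate k false

IsInducedOnPrefix : ∀ {d n k} → Hypergraph d n → Hypergraph d (n + k) → Set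
IsInducedOnPrefix {k = k} H H' = ∀ e → IsEdge H e ⇔ IsEdge H' (embed k e)

-- Give every vertex vᵢ of H a pendant edge {vᵢ, bᵢ} ∪ C, where the bᵢ are new
-- vertices and C is a set of d − 2 new vertices shared by all pendant edges.
-- No old edge meets a new vertex, so H is still induced on the old vertices.
-- Starting from the empty set: bᵢ lies in one edge only, so the rest of that
-- edge forces vᵢ; once all old vertices are blue, the only edges through vᵢ and
-- a white vertex are pendant edges, so {vᵢ} ∪ C forces bᵢ; finally every
-- c ∈ C is forced by the rest of any single pendant edge.
module Submission where

open import Defs
open import Data.Nat using (ℕ; zero; suc; _+_; _≤_; _<_; z≤n; s≤s)
open import Data.Nat.Properties using (+-identityʳ; +-suc; +-monoʳ-≤; m≤m+n; ≤-trans; ≤-reflexive; ≤-antisym; suc-injective)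
open import Data.Bool using (true; false)
open import Data.Empty using (⊥-elim)
open import Data.Fin using (Fin; zero; suc; _↑ˡ_; _↑ʳ_)
open import Data.Fin.Properties using (splitAt-↑ˡ; splitAt-↑ʳ; ↑ʳ-injective)
open import Data.Fin.Subset using (Subset; _∈_; _∉_; _⊆_; _∪_; _-_; ⁅_⁆; ∣_∣; ⊥; ⊤)
open import Data.Fin.Subset.Properties using (∉⊥; ∈⊤; ∣⊥∣≡0; ∣⊤∣≡n; ∣⁅x⁆∣≡1; ∣p∣≤n; ∣p∣≡n⇒p≡⊤; x∈⁅x⁆; x∈⁅y⁆⇒x≡y; p⊆p∪q; q⊆p∪q; x∈p∪q⁻; ∪-identityʳ; p─⊥≡p; x∈p∧x≢y⇒x∈p-y; p⊂q⇒∣p∣<∣q∣)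
open import Data.Vec using ([]; _∷_; _++_; splitAt; here; there)
open import Data.Vec.Properties using (lookup-++ˡ; lookup-++ʳ; lookup⇒[]=; []=⇒lookup; ++-injectiveˡ)
open import Data.Product using (Σ; _×_; _,_)
open import Data.Sum using (_⊎_; inj₁; inj₂)
open import Function using (_∘_; id)
open import Function.Bundles using (mk⇔)
open import Relation.Binary.PropositionalEquality using (_≡_; _≢_; refl; sym; trans; cong; cong₂; subst)
open import Relation.Binary.Construct.Closure.ReflexiveTransitive using (ε; _◅_)

∈-++⁺ˡ : ∀ {n k} {p : Subset n} (q : Subset k) {i} → i ∈ p → i ↑ˡ k ∈ p ++ q
∈-++⁺ˡ {p = p} q {i} i∈p = lookup⇒[]= _ (p ++ q) (trans (lookup-++ˡ p q i) ([]=⇒lookup i∈p))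

∈-++⁺ʳ : ∀ {n k} (p : Subset n) {q : Subset k} {j} → j ∈ q → n ↑ʳ j ∈ p ++ q
∈-++⁺ʳ p {q} {j} j∈q = lookup⇒[]= _ (p ++ q) (trans (lookup-++ʳ p q j) ([]=⇒lookup j∈q))

∈-++⁻ˡ : ∀ {n k} (p : Subset n) (q : Subset k) {i} → i ↑ˡ k ∈ p ++ q → i ∈ p
∈-++⁻ˡ p q {i} i∈ = lookup⇒[]= i p (trans (sym (lookup-++ˡ p q i)) ([]=⇒lookup i∈))

∈-++⁻ʳ : ∀ {n k} (p : Subset n) (q : Subset k) {j} → n ↑ʳ j ∈ p ++ q → j ∈ q
∈-++⁻ʳ p q {j} j∈ = lookup⇒[]= j q (trans (sym (lookup-++ʳ p q j)) ([]=⇒lookup j∈))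

↑ˡ≢↑ʳ : ∀ {n k} (i : Fin n) (j : Fin k) → i ↑ˡ k ≢ n ↑ʳ j
↑ˡ≢↑ʳ {n} {k} i j eq with trans (sym (splitAt-↑ˡ n i k)) (trans (cong (Data.Fin.splitAt n) eq) (splitAt-↑ʳ n k j))
... | ()

∣p++q∣ : ∀ {n k} (p : Subset n) (q : Subset k) → ∣ p ++ q ∣ ≡ ∣ p ∣ + ∣ q ∣
∣p++q∣ [] q = refl
∣p++q∣ (true ∷ p) q = cong suc (∣p++q∣ p q)
∣p++q∣ (false ∷ p) q = ∣p++q∣ p q

⊤++⊤ : ∀ n {k} → ⊤ {n} ++ ⊤ {k} ≡ ⊤
⊤++⊤ zero = refl
⊤++⊤ (suc n) = cong (true ∷_) (⊤++⊤ n)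

∉-or-≡⊤ : ∀ {n} (p : Subset n) → (Σ (Fin n) λ i → i ∉ p) ⊎ p ≡ ⊤
∉-or-≡⊤ [] = inj₂ refl
∉-or-≡⊤ (false ∷ p) = inj₁ (zero , λ ())
∉-or-≡⊤ (true ∷ p) with ∉-or-≡⊤ p
... | inj₁ (i , i∉p) = inj₁ (suc i , λ { (there i∈p) → i∉p i∈p })
... | inj₂ p≡⊤ = inj₂ (cong (true ∷_) p≡⊤)

x∉p-x : ∀ {n} (p : Subset n) x → x ∉ p - x
x∉p-x (_ ∷ p) zero ()
x∉p-x (_ ∷ p) (suc x) (there x∈) = x∉p-x p x x∈

x∈p-x∪⁅y⁆⇒x≡y : ∀ {n} (p : Subset n) {x y} → x ∈ (p - x) ∪ ⁅ y ⁆ → x ≡ y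
x∈p-x∪⁅y⁆⇒x≡y p {x} {y} x∈ with x∈p∪q⁻ (p - x) ⁅ y ⁆ x∈
... | inj₁ x∈p-x = ⊥-elim (x∉p-x p x x∈p-x)
... | inj₂ x∈⁅y⁆ = x∈⁅y⁆⇒x≡y y x∈⁅y⁆

∣p-x∣ : ∀ {n} {p : Subset n} {x} → x ∈ p → suc ∣ p - x ∣ ≡ ∣ p ∣
∣p-x∣ {p = true ∷ p} here = cong (suc ∘ ∣_∣) (p─⊥≡p p)
∣p-x∣ {p = true ∷ p} (there x∈p) = cong suc (∣p-x∣ x∈p)
∣p-x∣ {p = false ∷ p} (there x∈p) = ∣p-x∣ x∈p

p-x∪⁅x⁆≡p : ∀ {n} {p : Subset n} {x} → x ∈ p → (p - x) ∪ ⁅ x ⁆ ≡ p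
p-x∪⁅x⁆≡p {p = true ∷ p} here = cong (true ∷_) (trans (∪-identityʳ _) (p─⊥≡p p))
p-x∪⁅x⁆≡p {p = true ∷ p} (there x∈p) = cong (true ∷_) (p-x∪⁅x⁆≡p x∈p)
p-x∪⁅x⁆≡p {p = false ∷ p} (there x∈p) = cong (false ∷_) (p-x∪⁅x⁆≡p x∈p)

embed⊆⊤++ : ∀ {n k} (e : Subset n) (q : Subset k) → embed k e ⊆ ⊤ ++ q
embed⊆⊤++ [] q x∈ = ⊥-elim (∉⊥ x∈)
embed⊆⊤++ (_ ∷ e) q here = here
embed⊆⊤++ (_ ∷ e) q (there x∈) = there (embed⊆⊤++ e q x∈)

∣embed∣ : ∀ {n} k (e : Subset n) → ∣ embed k e ∣ ≡ ∣ e ∣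
∣embed∣ k e = trans (∣p++q∣ e ⊥) (trans (cong (∣ e ∣ +_) (∣⊥∣≡0 k)) (+-identityʳ ∣ e ∣))

CanForce : ∀ {d n} → Hypergraph d n → Subset n → Set
CanForce {n = n} H B = Σ (Fin n) λ w → w ∉ B × ForceStep H B (B ∪ ⁅ w ⁆)

canForce-along : ∀ {d n} (H : Hypergraph (suc d) n) {B f w}
  → IsEdge H f → w ∈ f → w ∉ B
  → (∀ {g u} → IsEdge H g → f - w ⊆ g → u ∈ g → u ∉ B → g ≡ f)
  → CanForce H B
canForce-along {d} H {B} {f} {w} f∈H w∈f w∉B only-f =
  w , w∉B , force (f - w) w ∣f-w∣ w∉B (subst (IsEdge H) (sym (p-x∪⁅x⁆≡p w∈f)) f∈H) forced
  where
  ∣f-w∣ : ∣ f - w ∣ ≡ d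
  ∣f-w∣ = suc-injective (trans (∣p-x∣ w∈f) (uniform H f f∈H))

  forced : ∀ u → u ∉ B → IsEdge H ((f - w) ∪ ⁅ u ⁆) → u ≡ w
  forced u u∉B g∈H = sym (x∈p-x∪⁅y⁆⇒x≡y f (subst (w ∈_) (sym g≡f) w∈f))
    where
    g≡f : (f - w) ∪ ⁅ u ⁆ ≡ f
    g≡f = only-f g∈H (p⊆p∪q ⁅ u ⁆) (q⊆p∪q (f - w) ⁅ u ⁆ (x∈⁅x⁆ u)) u∉B

everySet-isZeroForcing : ∀ {d n} (H : Hypergraph d n)
  → (∀ B → CanForce H B ⊎ B ≡ ⊤) → ∀ B → IsZeroForcingSet H B
everySet-isZeroForcing {n = n} H progress B = go n B (m≤m+n n ∣ B ∣)
  where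
  go : ∀ c B → n ≤ c + ∣ B ∣ → IsZeroForcingSet H B
  go zero B n≤∣B∣ = subst (IsZeroForcingSet H) (sym (∣p∣≡n⇒p≡⊤ (≤-antisym (∣p∣≤n B) n≤∣B∣))) ε
  go (suc c) B n≤ with progress B
  ... | inj₂ refl = ε
  ... | inj₁ (w , w∉B , step) =
    step ◅ go c (B ∪ ⁅ w ⁆) (≤-trans n≤ (≤-trans (≤-reflexive (sym (+-suc c ∣ B ∣))) (+-monoʳ-≤ c ∣B∣<∣B∪w∣)))
    where
    ∣B∣<∣B∪w∣ : ∣ B ∣ < ∣ B ∪ ⁅ w ⁆ ∣
    ∣B∣<∣B∪w∣ = p⊂q⇒∣p∣<∣q∣ (p⊆p∪q ⁅ w ⁆ , w , q⊆p∪q B ⁅ w ⁆ (x∈⁅x⁆ w) , w∉B)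

Z₀≡0 : ∀ {d n} {H : Hypergraph d n} → IsZeroForcingSet H ⊥ → Z₀≡ H 0
Z₀≡0 {n = n} ⊥-forces = (⊥ , ⊥-forces , ∣⊥∣≡0 n) , λ _ _ → z≤n

module PendantExtension {m N : ℕ} (H : Hypergraph (2 + m) N) (i₀ : Fin N) where

  k : ℕ
  k = N + m

  old : Fin N → Fin (N + k)
  old i = i ↑ˡ k

  pendant : Fin N → Fin (N + k)
  pendant i = N ↑ʳ (i ↑ˡ m)

  shared : Fin m → Fin (N + k)
  shared l = N ↑ʳ (N ↑ʳ l)

  pendantEdge : Fin N → Subset (N + k)
  pendantEdge i = ⁅ i ⁆ ++ (⁅ i ⁆ ++ ⊤)

  IsEdge′ : Subset (N + k) → Set
  IsEdge′ f = (Σ (Subset N) λ e → f ≡ embed k e × IsEdge H e) ⊎ (Σ (Fin N) λ i → f ≡ pendantEdge i)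

  uniform′ : ∀ f → IsEdge′ f → ∣ f ∣ ≡ 2 + m
  uniform′ _ (inj₁ (e , refl , e∈H)) = trans (∣embed∣ k e) (uniform H e e∈H)
  uniform′ _ (inj₂ (i , refl)) =
    trans (∣p++q∣ ⁅ i ⁆ (⁅ i ⁆ ++ ⊤))
      (cong₂ _+_ (∣⁅x⁆∣≡1 i) (trans (∣p++q∣ ⁅ i ⁆ ⊤) (cong₂ _+_ (∣⁅x⁆∣≡1 i) (∣⊤∣≡n m))))

  H′ : Hypergraph (2 + m) (N + k)
  H′ = record { IsEdge = IsEdge′ ; uniform = uniform′ }

  old∈pendantEdge : ∀ i → old i ∈ pendantEdge i
  old∈pendantEdge i = ∈-++⁺ˡ (⁅ i ⁆ ++ ⊤) (x∈⁅x⁆ i)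

  pendant∈pendantEdge : ∀ i → pendant i ∈ pendantEdge i
  pendant∈pendantEdge i = ∈-++⁺ʳ ⁅ i ⁆ (∈-++⁺ˡ ⊤ (x∈⁅x⁆ i))

  shared∈pendantEdge : ∀ i l → shared l ∈ pendantEdge i
  shared∈pendantEdge i l = ∈-++⁺ʳ ⁅ i ⁆ (∈-++⁺ʳ ⁅ i ⁆ ∈⊤)

  induced : IsInducedOnPrefix H H′
  induced e = mk⇔ (λ e∈H → inj₁ (e , refl , e∈H)) restrict
    where
    restrict : IsEdge′ (embed k e) → IsEdge H e
    restrict (inj₁ (e′ , eq , e′∈H)) = subst (IsEdge H) (sym (++-injectiveˡ e e′ eq)) e′∈H
    restrict (inj₂ (i , eq)) = ⊥-elim (∉⊥ (∈-++⁻ʳ e ⊥ (subst (pendant i ∈_) (sym eq) (pendant∈pendantEdge i))))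

  -- u ∉ ⊤ ++ Q says that u is one of the new vertices.
  ∋new⇒pendantEdge : ∀ {g u} (Q : Subset k) → IsEdge′ g → u ∈ g → u ∉ ⊤ {N} ++ Q
    → Σ (Fin N) λ j → g ≡ pendantEdge j
  ∋new⇒pendantEdge Q (inj₁ (e , refl , _)) u∈g u∉ = ⊥-elim (u∉ (embed⊆⊤++ e Q u∈g))
  ∋new⇒pendantEdge Q (inj₂ g-pendant) _ _ = g-pendant

  ∋pendant⇒pendantEdge : ∀ {g i} → IsEdge′ g → pendant i ∈ g → g ≡ pendantEdge i
  ∋pendant⇒pendantEdge {i = i} g∈H′ p∈g
    with ∋new⇒pendantEdge ⊥ g∈H′ p∈g (∉⊥ ∘ ∈-++⁻ʳ (⊤ {N}) ⊥)
  ... | j , refl = cong pendantEdge (sym (x∈⁅y⁆⇒x≡y j (∈-++⁻ˡ ⁅ j ⁆ ⊤ (∈-++⁻ʳ ⁅ j ⁆ (⁅ j ⁆ ++ ⊤) p∈g))))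

  ∋old∧new⇒pendantEdge : ∀ {g i u} (Q : Subset k) → IsEdge′ g → old i ∈ g → u ∈ g → u ∉ ⊤ {N} ++ Q
    → g ≡ pendantEdge i
  ∋old∧new⇒pendantEdge Q g∈H′ o∈g u∈g u∉
    with ∋new⇒pendantEdge Q g∈H′ u∈g u∉
  ... | j , refl = cong pendantEdge (sym (x∈⁅y⁆⇒x≡y j (∈-++⁻ˡ ⁅ j ⁆ (⁅ j ⁆ ++ ⊤) o∈g)))

  forceOld : ∀ (P : Subset N) (Q : Subset k) {i} → i ∉ P → CanForce H′ (P ++ Q)
  forceOld P Q {i} i∉P =
    canForce-along H′ (inj₂ (i , refl)) (old∈pendantEdge i) (i∉P ∘ ∈-++⁻ˡ P Q)
      λ g∈H′ f-w⊆g _ _ → ∋pendant⇒pendantEdge g∈H′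
        (f-w⊆g (x∈p∧x≢y⇒x∈p-y (pendant∈pendantEdge i) (↑ˡ≢↑ʳ i _ ∘ sym)))

  forcePendant : ∀ (Q : Subset N) (R : Subset m) {i} → i ∉ Q → CanForce H′ (⊤ {N} ++ (Q ++ R))
  forcePendant Q R {i} i∉Q =
    canForce-along H′ (inj₂ (i , refl)) (pendant∈pendantEdge i)
      (i∉Q ∘ ∈-++⁻ˡ Q R ∘ ∈-++⁻ʳ ⊤ (Q ++ R))
      λ g∈H′ f-w⊆g u∈g u∉ → ∋old∧new⇒pendantEdge (Q ++ R) g∈H′
        (f-w⊆g (x∈p∧x≢y⇒x∈p-y (old∈pendantEdge i) (↑ˡ≢↑ʳ i _))) u∈g u∉

  forceShared : ∀ (R : Subset m) {l} → l ∉ R → CanForce H′ (⊤ {N} ++ (⊤ {N} ++ R))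
  forceShared R {l} l∉R =
    canForce-along H′ (inj₂ (i₀ , refl)) (shared∈pendantEdge i₀ l)
      (l∉R ∘ ∈-++⁻ʳ (⊤ {N}) R ∘ ∈-++⁻ʳ (⊤ {N}) (⊤ ++ R))
      λ g∈H′ f-w⊆g _ _ → ∋pendant⇒pendantEdge g∈H′
        (f-w⊆g (x∈p∧x≢y⇒x∈p-y (pendant∈pendantEdge i₀) (↑ˡ≢↑ʳ i₀ l ∘ ↑ʳ-injective N _ _)))

  progress : ∀ B → CanForce H′ B ⊎ B ≡ ⊤
  progress B with splitAt N B
  ... | P , B′ , refl with splitAt N B′
  ... | Q , R , refl with ∉-or-≡⊤ P
  ... | inj₁ (_ , i∉P) = inj₁ (forceOld P (Q ++ R) i∉P)
  ... | inj₂ refl with ∉-or-≡⊤ Q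
  ... | inj₁ (_ , i∉Q) = inj₁ (forcePendant Q R i∉Q)
  ... | inj₂ refl with ∉-or-≡⊤ R
  ... | inj₁ (_ , l∉R) = inj₁ (forceShared R l∉R)
  ... | inj₂ refl = inj₂ (trans (cong (⊤ {N} ++_) (⊤++⊤ N)) (⊤++⊤ N))

  Z₀[H′]≡0 : Z₀≡ H′ 0
  Z₀[H′]≡0 = Z₀≡0 (everySet-isZeroForcing H′ progress ⊥)

proposition3p19 : (d n : ℕ) → 2 ≤ d → (H : Hypergraph d n)
    → Σ ℕ λ k → Σ (Hypergraph d (n + k)) λ H' → IsInducedOnPrefix H H' × Z₀≡ H' 0
proposition3p19 (suc zero) _ (s≤s ()) _
proposition3p19 (suc (suc m)) zero _ H = 0 , H , (λ { [] → mk⇔ id id }) , Z₀≡0 ε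
proposition3p19 (suc (suc m)) (suc n) _ H = k , H′ , induced , Z₀[H′]≡0
  where open PendantExtension H zero
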